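{- Let $G$ be a connected graph with $|V(G)|\ge 3$, let $(T,L)$ be a rank-decomposition of $G$, $x$ a leaf of $T$, with edges oriented away from $x$, and let $\{U_e\}$, $\{C_f\}$ be as in the construction of a rank-expansion. Let $n\ge 1$ and let $P=(e_{n+1},e_n,\ldots,e_1)$ be a directed path in $T$ (so the head of $e_{i+1}$ is the tail of $e_i$ for $1\le i\le n$). Then $C_{e_1}C_{e_2}\cdots C_{e_n}\,A(G)[U_{e_{n+1}},B_{e_{n+1}}]=A(G)[U_{e_1},B_{e_{n+1}}].$
   Context: $A(G)$ is the adjacency matrix of $G$ over $GF(2)$; $M[X,Y]$ is the submatrix with rows $X$ and columns $Y$. A tree is subcubic if it has at least two vertices and every vertex of degree other than $1$ has degree $3$; a rank-decomposition of $G$ is a pair $(T,L)$ with $T$ a subcubic tree and $L$ a bijection from $V(G)$ to the leaves of $T$. With edges of $T$ oriented away from the leaf $x$: for $e\in E(T)$, $T_e$ is the component of $T\setminus e$ not containing $x$, $A_e=L^{ -1}(V(T_e))$, $B_e=V(G)\setminus A_e$, $M_e=A(G)[A_e,B_e]$. The sets $U_e\subseteq A_e$ are chosen so that (i) the rows of $M_e$ indexed by $U_e$ form a basis of the row space of $M_e$, and (ii) $U_e\cap A_f\subseteq U_f$ whenever the head of $e$ is the tail of $f$. $P_e$ is the unique $A_e\times U_e$ matrix over $GF(2)$ with $P_eA(G)[U_e,B_e]=A(G)[A_e,B_e]$, and if the tail of $f$ is the head of $e$ then $C_f=P_e[U_f,U_e]$. -}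

module Defs where

open import Data.Nat using (ℕ; zero; suc; _+_; _≤_)
open import Data.Fin using (Fin; zero; suc)
open import Data.Bool using (Bool; true; false; _∧_; _xor_; if_then_else_)
open import Data.Product using (Σ; _×_; _,_; ∃; proj₁; proj₂)
open import Data.Sum using (_⊎_)
open import Data.Unit using (⊤)
open import Data.List using (List; []; _∷_)
open import Relation.Binary.PropositionalEquality using (_≡_)
open import Relation.Nullary using (¬_)
open import Function.Definitions using (Injective)

-- Matrices over GF(2) = Bool (xor = +, ∧ = ·), indexed by Fin N × Fin N.
-- A submatrix M[X,Y] is represented by the full matrix; equalities of
-- submatrices are asserted only on the index set X × Y.
Mat : ℕ → Set
Mat N = Fin N → Fin N → Bool

xorSum : ∀ {N} → (Fin N → Bool) → Bool
xorSum {zero}  f = false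
xorSum {suc N} f = f zero xor xorSum (λ i → f (suc i))

-- product M[-,S] · K[S,-] (summing only over the index subset S)
mulOver : ∀ {N} → (Fin N → Bool) → Mat N → Mat N → Mat N
mulOver S M K i j = xorSum (λ k → S k ∧ (M i k ∧ K k j))

count : ∀ {m} → (Fin m → Bool) → ℕ
count {zero}  f = 0
count {suc m} f = (if f zero then 1 else 0) + count (λ i → f (suc i))

degree : ∀ {m} → Mat m → Fin m → ℕ
degree adj v = count (adj v)

SimpleGraph : ∀ {m} → Mat m → Set
SimpleGraph adj = (∀ a b → adj a b ≡ adj b a) × (∀ a → adj a a ≡ false)

data Walk {k : ℕ} (E : Fin k → Fin k → Set) : Fin k → Fin k → Set where
  here : ∀ {a} → Walk E a a
  step : ∀ {a b c} → E a b → Walk E b c → Walk E a c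

Edge : ∀ {m} → Mat m → Fin m → Fin m → Set
Edge adj a b = adj a b ≡ true

EdgeMinus : ∀ {m} → Mat m → Fin m → Fin m → Fin m → Fin m → Set
EdgeMinus adj u v a b = adj a b ≡ true × ¬ (a ≡ u × b ≡ v) × ¬ (a ≡ v × b ≡ u)

Connected : ∀ {m} → Mat m → Set
Connected adj = ∀ a b → Walk (Edge adj) a b

IsTree : ∀ {m} → Mat m → Set
IsTree adj = SimpleGraph adj × Connected adj
           × (∀ u v → adj u v ≡ true → ¬ Walk (EdgeMinus adj u v) u v)

IsLeaf : ∀ {m} → Mat m → Fin m → Set
IsLeaf adj v = degree adj v ≡ 1

IsSubcubicTree : ∀ {m} → Mat m → Set
IsSubcubicTree {m} adj = 2 ≤ m × IsTree adj
                       × (∀ v → degree adj v ≡ 1 ⊎ degree adj v ≡ 3)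

IsRankDecomposition : ∀ {N m} → Mat m → (Fin N → Fin m) → Set
IsRankDecomposition T L = IsSubcubicTree T × Injective _≡_ _≡_ L
                        × (∀ g → IsLeaf T (L g))
                        × (∀ t → IsLeaf T t → ∃ λ g → L g ≡ t)

-- for the directed edge e = (u,v) (tail u, head v): w ∈ V(T_e), the
-- component of T \ e containing the head v
InComponent : ∀ {m} → Mat m → Fin m → Fin m → Fin m → Set
InComponent T u v w = Walk (EdgeMinus T u v) v w

-- (u,v) is an edge of T oriented away from x (x ∉ T_e)
OrientedAway : ∀ {m} → Mat m → Fin m → Fin m → Fin m → Set
OrientedAway T x u v = T u v ≡ true × ¬ InComponent T u v x

Aset : ∀ {N m} → Mat m → (Fin N → Fin m) → Fin m → Fin m → Fin N → Set
Aset T L u v g = InComponent T u v (L g)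

Bset : ∀ {N m} → Mat m → (Fin N → Fin m) → Fin m → Fin m → Fin N → Set
Bset T L u v g = ¬ Aset T L u v g

-- rows of M = AG[A,B] (B = complement of A) indexed by U ⊆ A form a basis
-- of the row space of M: linearly independent and spanning every row.
IsRowBasis : ∀ {N} → Mat N → (Fin N → Set) → (Fin N → Bool) → Set
IsRowBasis {N} AG A U =
    (∀ g → U g ≡ true → A g)
  × (∀ (c : Fin N → Bool)
       → (∀ b → ¬ A b → xorSum (λ k → U k ∧ (c k ∧ AG k b)) ≡ false)
       → ∀ k → U k ≡ true → c k ≡ false)
  × (∀ a → A a → ∃ λ (c : Fin N → Bool) →
       ∀ b → ¬ A b → AG a b ≡ xorSum (λ k → U k ∧ (c k ∧ AG k b)))

OrientedChain : ∀ {m} → Mat m → Fin m → List (Fin m) → Set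
OrientedChain T x (a ∷ b ∷ rest) = OrientedAway T x a b × OrientedChain T x (b ∷ rest)
OrientedChain T x _ = ⊤

-- Given the previous edge e = (u,v) and remaining vertices, multiply
-- successively on the left by C_f = P_e[U_f , U_e] for f = (v,w).
chainProd : ∀ {N m} → (Fin m → Fin m → Fin N → Bool) → (Fin m → Fin m → Mat N)
          → Fin m → Fin m → List (Fin m) → Mat N → Mat N
chainProd U P u v []         M = M
chainProd U P u v (w ∷ rest) M = chainProd U P v w rest (mulOver (U u v) (P u v) M)

lastEdge : ∀ {m} → Fin m → Fin m → List (Fin m) → Fin m × Fin m
lastEdge u v []         = u , v
lastEdge u v (w ∷ rest) = lastEdge v w rest

module Submission where

-- Write C_f = P_e[U_f,U_e] for consecutive edges e = (u,v),
-- f = (v,w) of the path and M for the partial product built so far.  We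
-- keep the invariant "M[k,b] = A(G)[k,b] for every row k ∈ U_e", where b is
-- the fixed column, b ∈ B_{e_{n+1}}.  One more multiplication keeps it:
-- for k ∈ U_f ⊆ A_f ⊆ A_e the new entry is (P_e M)[k,b] = (P_e A(G))[k,b],
-- since only rows of U_e are summed, and this is A(G)[k,b] by the defining
-- property of P_e because b ∈ B_e.  Moreover b stays in B_f, because the
-- branches of a directed path are nested: A_f ⊆ A_e.

open import Defs
open import Data.Nat using (ℕ; zero; suc; _≤_)
open import Data.Fin using (Fin; _≟_)
open import Data.Bool using (Bool; true; false; _∧_; _xor_)
open import Data.Product using (proj₁; proj₂; _,_)
open import Data.Sum using (_⊎_; inj₁; inj₂)
open import Data.Empty using (⊥-elim)
open import Data.List using (List; _∷_; [])
open import Relation.Binary.PropositionalEquality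
  using (_≡_; refl; sym; trans; subst; cong; cong₂)
open import Relation.Nullary using (¬_; yes; no)
open import Relation.Nullary.Decidable using (_×-dec_)

mapWalk : ∀ {k} {E E' : Fin k → Fin k → Set} → (∀ {a b} → E a b → E' a b)
        → ∀ {a b} → Walk E a b → Walk E' a b
mapWalk f here       = here
mapWalk f (step e w) = step (f e) (mapWalk f w)

xorSum-cong : ∀ {N} {f g : Fin N → Bool} → (∀ k → f k ≡ g k) → xorSum f ≡ xorSum g
xorSum-cong {zero}  h = refl
xorSum-cong {suc N} h = cong₂ _xor_ (h Fin.zero) (xorSum-cong (λ i → h (Fin.suc i)))

mulOver-column-cong : ∀ {N} (S : Fin N → Bool) (P M K : Mat N) (b : Fin N)
  → (∀ k → S k ≡ true → M k b ≡ K k b)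
  → ∀ i → mulOver S P M i b ≡ mulOver S P K i b
mulOver-column-cong S P M K b agree i = xorSum-cong guarded
  where
  guarded : ∀ k → S k ∧ (P i k ∧ M k b) ≡ S k ∧ (P i k ∧ K k b)
  guarded k with S k in sk
  ... | true  = cong (P i k ∧_) (agree k sk)
  ... | false = refl

module TreeBranches {m : ℕ} (T : Mat m) (tree : IsTree T) where

  private
    symT   = proj₁ (proj₁ tree)
    loopT  = proj₂ (proj₁ tree)
    connT  = proj₁ (proj₂ tree)
    bridge = proj₂ (proj₂ tree)

  minus-sym : ∀ {u v a b} → EdgeMinus T u v a b → EdgeMinus T u v b a
  minus-sym {a = a} {b} (e , n₁ , n₂) =
    trans (symT b a) e , (λ (p , q) → n₂ (q , p)) , (λ (p , q) → n₁ (q , p))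

  minus-flip : ∀ {u v a b} → EdgeMinus T u v a b → EdgeMinus T v u a b
  minus-flip (e , n₁ , n₂) = e , n₂ , n₁

  edge-distinct : ∀ {u v} → T u v ≡ true → ¬ u ≡ v
  edge-distinct {u} e refl with trans (sym e) (loopT u)
  ... | ()

  -- Since vw is a bridge, the side of T∖vw containing w avoids v; hence a
  -- walk in T∖vw that starts on that side never uses the edge uv either.
  stays-off-tail : ∀ {u v w} → ¬ Walk (EdgeMinus T v w) v w → ∀ {z y}
    → Walk (EdgeMinus T v w) z w → Walk (EdgeMinus T v w) z y
    → Walk (EdgeMinus T u v) z y
  stays-off-tail noBack toW here = here
  stays-off-tail {v = v} {w} noBack {z} toW (step {b = z'} e W) with z ≟ v | z' ≟ v
  ... | yes z≡v | _ = ⊥-elim (noBack (subst (λ t → Walk (EdgeMinus T v w) t w) z≡v toW))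
  ... | no _ | yes z'≡v =
    ⊥-elim (noBack (subst (λ t → Walk (EdgeMinus T v w) t w) z'≡v (step (minus-sym e) toW)))
  ... | no z≢v | no z'≢v =
    step (proj₁ e , (λ (_ , q) → z'≢v q) , (λ (p , _) → z≢v p))
         (stays-off-tail noBack (step (minus-sym e) toW) W)

  branch-nested : ∀ {u v w y} → T u v ≡ true → T v w ≡ true → ¬ w ≡ u
    → InComponent T v w y → InComponent T u v y
  branch-nested tuv tvw w≢u W =
    step (tvw , (λ (p , _) → edge-distinct tuv (sym p)) , (λ (_ , q) → w≢u q))
         (stays-off-tail (bridge _ _ tvw) here W)

  last-crossing : ∀ {u v z y} → Walk (Edge T) z y
    → Walk (EdgeMinus T u v) z y ⊎ (Walk (EdgeMinus T u v) u y ⊎ Walk (EdgeMinus T u v) v y)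
  last-crossing here = inj₁ here
  last-crossing {u} {v} {z} {y} (step {b = z'} e W) with last-crossing {u} {v} W
  ... | inj₂ r = inj₂ r
  ... | inj₁ W' with (z ≟ u ×-dec z' ≟ v) | (z ≟ v ×-dec z' ≟ u)
  ... | yes (_ , z'≡v) | _ = inj₂ (inj₂ (subst (λ t → Walk (EdgeMinus T u v) t y) z'≡v W'))
  ... | no _ | yes (_ , z'≡u) = inj₂ (inj₁ (subst (λ t → Walk (EdgeMinus T u v) t y) z'≡u W'))
  ... | no n₁ | no n₂ = inj₁ (step (e , n₁ , n₂) W')

  -- A path directed away from x never turns back: x lies on one side of
  -- uv, so uv and vu cannot both be oriented away from x.
  no-backtrack : ∀ {x u v w} → OrientedAway T x u v → OrientedAway T x v w → ¬ w ≡ u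
  no-backtrack {x} {u} {v} (_ , xNotBehindV) (_ , xNotBehindU) refl
    with last-crossing {u} {v} (connT u x)
  ... | inj₁ W        = xNotBehindU (mapWalk minus-flip W)
  ... | inj₂ (inj₁ W) = xNotBehindU (mapWalk minus-flip W)
  ... | inj₂ (inj₂ W) = xNotBehindV W

  Aset-nested : ∀ {N} (L : Fin N → Fin m) {x u v w}
    → OrientedAway T x u v → OrientedAway T x v w
    → ∀ g → Aset T L v w g → Aset T L u v g
  Aset-nested L e f g = branch-nested (proj₁ e) (proj₁ f) (no-backtrack e f)

AgreesOn : ∀ {N} → (Fin N → Bool) → Mat N → Mat N → Fin N → Set
AgreesOn S M AG b = ∀ k → S k ≡ true → M k b ≡ AG k b

module DirectedPath {N m : ℕ} (AG : Mat N) (T : Mat m) (tree : IsTree T)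
  (L : Fin N → Fin m) (x : Fin m)
  (U : Fin m → Fin m → Fin N → Bool) (P : Fin m → Fin m → Mat N)
  (U⊆A : ∀ u v → OrientedAway T x u v → ∀ g → U u v g ≡ true → Aset T L u v g)
  (P-reproduces : ∀ u v → OrientedAway T x u v → ∀ a b → Aset T L u v a → Bset T L u v b
     → mulOver (U u v) (P u v) AG a b ≡ AG a b)
  (b : Fin N) where

  open TreeBranches T tree using (Aset-nested)

  step-agrees : ∀ {u v w} (M : Mat N) → OrientedAway T x u v → OrientedAway T x v w
    → Bset T L u v b → AgreesOn (U u v) M AG b
    → AgreesOn (U v w) (mulOver (U u v) (P u v) M) AG b
  step-agrees {u} {v} {w} M e f b∈B agree k k∈Uf =
    trans (mulOver-column-cong (U u v) (P u v) M AG b agree k)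
          (P-reproduces u v e k b (Aset-nested L e f k (U⊆A v w f k k∈Uf)) b∈B)

  step-outside : ∀ {u v w} → OrientedAway T x u v → OrientedAway T x v w
    → Bset T L u v b → Bset T L v w b
  step-outside e f b∈B b∈Af = b∈B (Aset-nested L e f b b∈Af)

  chain-agrees : ∀ u v (rest : List (Fin m)) (M : Mat N)
    → OrientedChain T x (u ∷ v ∷ rest)
    → Bset T L u v b → AgreesOn (U u v) M AG b
    → AgreesOn (U (proj₁ (lastEdge u v rest)) (proj₂ (lastEdge u v rest)))
               (chainProd U P u v rest M) AG b
  chain-agrees u v []         M _           _   agree = agree
  chain-agrees u v (w ∷ rest) M (e , chain) b∈B agree =
    chain-agrees v w rest (mulOver (U u v) (P u v) M) chain
      (step-outside e f b∈B) (step-agrees M e f b∈B agree)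
    where
    f : OrientedAway T x v w
    f = proj₁ chain

lemma3p7 : ∀ {N m : ℕ} (AG : Mat N) (T : Mat m) (L : Fin N → Fin m) (x : Fin m)
    (U : Fin m → Fin m → Fin N → Bool) (P : Fin m → Fin m → Mat N)
    → SimpleGraph AG → Connected AG → 3 ≤ N
    → IsRankDecomposition T L → IsLeaf T x
    → (∀ u v → OrientedAway T x u v → IsRowBasis AG (Aset T L u v) (U u v))
    → (∀ u v w → OrientedAway T x u v → OrientedAway T x v w
    → ∀ g → U u v g ≡ true → Aset T L v w g → U v w g ≡ true)
    → (∀ u v → OrientedAway T x u v → ∀ a b → Aset T L u v a → Bset T L u v b
    → mulOver (U u v) (P u v) AG a b ≡ AG a b)
    → ∀ v₀ v₁ v₂ (rest : List (Fin m)) → OrientedChain T x (v₀ ∷ v₁ ∷ v₂ ∷ rest)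
    → ∀ a b → U (proj₁ (lastEdge v₁ v₂ rest)) (proj₂ (lastEdge v₁ v₂ rest)) a ≡ true
    → Bset T L v₀ v₁ b
    → chainProd U P v₀ v₁ (v₂ ∷ rest) AG a b ≡ AG a b
lemma3p7 AG T L x U P _ _ _ rankDec _ basis _ P-reproduces v₀ v₁ v₂ rest chain a b a∈U b∈B =
  chain-agrees v₀ v₁ (v₂ ∷ rest) AG chain b∈B (λ _ _ → refl) a a∈U
  where
  tree : IsTree T
  tree = proj₁ (proj₂ (proj₁ rankDec))

  U⊆A : ∀ u v → OrientedAway T x u v → ∀ g → U u v g ≡ true → Aset T L u v g
  U⊆A u v e = proj₁ (basis u v e)

  open DirectedPath AG T tree L x U P U⊆A P-reproduces b
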